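{- For all integers $n\ge 0$ and $0\le k\le n$, $\binom{0,n}{k,2}=2^{n-k}\binom{n}{k}$.
   Context: For a finite list $Q=\{q_1,\dots,q_n\}$ of positive integers (repetitions allowed) and a nonnegative integer $m$, let $X$ be a set which is the disjoint union of "main blocks" $X_1,\dots,X_n$ with $|X_i|=q_i$ and an "additional block" $Y$ with $|Y|=m$. An $(n+k)$-inset of $X$ is an $(n+k)$-element subset of $X$ that intersects every main block. The number of $(n+k)$-insets of $X$ is denoted $\binom{m,n}{k,Q}$; when $q_1=\dots=q_n=q$ one writes $\binom{m,n}{k,q}$. -}

module Defs where

open import Data.Nat using (ℕ; zero; suc; _+_; _≟_)
open import Data.Bool using (Bool; true; false; _∧_)
open import Data.List using (List; []; _∷_; map; concatMap; filter; length; cartesianProductWith)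
open import Data.Vec using (Vec; []; _∷_)
open import Data.Fin.Subset using (Subset; ∣_∣; inside; outside)
open import Data.Fin.Subset.Properties using (nonempty?)
open import Relation.Nullary.Decidable using (⌊_⌋)
open import Data.List.Relation.Unary.All using (All)

allSubsets : (q : ℕ) → List (Subset q)
allSubsets zero = [] ∷ []
allSubsets (suc q) = concatMap (λ s → (inside ∷ s) ∷ (outside ∷ s) ∷ []) (allSubsets q)

-- The ground set X = X₁ ⊔ … ⊔ Xₙ ⊔ Y with |Xᵢ| = qᵢ and |Y| = m.
data BlockSubsets : List ℕ → Set where
  []  : BlockSubsets []
  _∷_ : ∀ {q Q} → Subset q → BlockSubsets Q → BlockSubsets (q ∷ Q)

allBlockSubsets : (Q : List ℕ) → List (BlockSubsets Q)
allBlockSubsets [] = [] ∷ []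
allBlockSubsets (q ∷ Q) = cartesianProductWith _∷_ (allSubsets q) (allBlockSubsets Q)

size : ∀ {Q} → BlockSubsets Q → ℕ
size [] = 0
size (s ∷ ss) = ∣ s ∣ + size ss

meetsAll : ∀ {Q} → BlockSubsets Q → Bool
meetsAll [] = true
meetsAll (s ∷ ss) = ⌊ nonempty? s ⌋ ∧ meetsAll ss

record SubsetX (Q : List ℕ) (m : ℕ) : Set where
  constructor _,_
  field
    mainPart : BlockSubsets Q
    addPart  : Subset m

allSubsetsX : (Q : List ℕ) (m : ℕ) → List (SubsetX Q m)
allSubsetsX Q m = cartesianProductWith _,_ (allBlockSubsets Q) (allSubsets m)

cardX : ∀ {Q m} → SubsetX Q m → ℕ
cardX (ss , y) = size ss + ∣ y ∣

isInset : ∀ {Q m} → ℕ → SubsetX Q m → Bool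
isInset {Q} k (ss , y) = meetsAll ss ∧ ⌊ cardX (ss , y) ≟ length Q + k ⌋

-- binom(m,n ; k,Q): the number of (n+k)-insets of X, n = length Q
insetCount : (m : ℕ) (Q : List ℕ) (k : ℕ) → ℕ
insetCount m Q k = length (Data.List.filter (λ S → isInset k S Data.Bool.≟ true) (allSubsetsX Q m))

-- Each main block has two elements, so a set meeting it takes either one of its
-- two elements or both. An (n+k)-inset of X (with no additional block) therefore
-- takes both elements of exactly k blocks and one of the two of each remaining
-- block. Formally, conditioning on the first block gives a Pascal-type recurrence
-- for the number of insets of a given size, and 2^(n∸k)·C(n,k) satisfies it.
module Submission where

open import Defs
open import Data.Nat using (ℕ; zero; suc; _+_; _*_; _^_; _∸_; _≤_; _<_; _≡ᵇ_; _≟_; s≤s; z≤n)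
open import Data.Nat.Properties
  using (+-suc; +-identityʳ; *-assoc; *-distribˡ-+; *-zeroʳ; +-∸-assoc; ≤-trans; ≤-reflexive; n≤1+n; ≮⇒≥; _<?_)
open import Data.Nat.Combinatorics using (_C_; nCk≡nC[n∸k]; nCn≡1; k>n⇒nCk≡0; nCk+nC[k+1]≡[n+1]C[k+1])
open import Data.Bool using (Bool; true; false; _∧_)
import Data.Bool as Bool
open import Data.Bool.Properties using (∧-zeroʳ)
open import Data.List using (List; []; _∷_; _++_; map; filter; length; replicate; cartesianProductWith)
open import Data.Nat.ListAction using (sum)
open import Data.List.Properties using (length-++; filter-++; length-replicate)
open import Data.Vec using ([])
open import Function using (_∘_)
open import Relation.Nullary.Decidable using (isYes; isYes≗does; yes; no)
open import Relation.Binary.PropositionalEquality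
  using (_≡_; refl; sym; trans; cong; cong₂; module ≡-Reasoning)

private
  variable
    A B R : Set

countᵇ : (A → Bool) → List A → ℕ
countᵇ p xs = length (filter (λ x → p x Bool.≟ true) xs)

countᵇ-++ : (p : A → Bool) (xs ys : List A) → countᵇ p (xs ++ ys) ≡ countᵇ p xs + countᵇ p ys
countᵇ-++ p xs ys = trans (cong length (filter-++ p? xs ys)) (length-++ (filter p? xs))
  where p? = λ x → p x Bool.≟ true

countᵇ-cong : {p q : A → Bool} → (∀ x → p x ≡ q x) → (xs : List A) → countᵇ p xs ≡ countᵇ q xs
countᵇ-cong p≗q [] = refl
countᵇ-cong {p = p} {q = q} p≗q (x ∷ xs) with p x | q x | p≗q x
... | true  | true  | refl = cong suc (countᵇ-cong p≗q xs)
... | false | false | refl = countᵇ-cong p≗q xs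

countᵇ-false : (xs : List A) → countᵇ (λ _ → false) xs ≡ 0
countᵇ-false [] = refl
countᵇ-false (x ∷ xs) = countᵇ-false xs

countᵇ-map : (p : B → Bool) (f : A → B) (xs : List A) → countᵇ p (map f xs) ≡ countᵇ (p ∘ f) xs
countᵇ-map p f [] = refl
countᵇ-map p f (x ∷ xs) with p (f x)
... | true  = cong suc (countᵇ-map p f xs)
... | false = countᵇ-map p f xs

countᵇ-cartesianProductWith : (p : R → Bool) (f : A → B → R) (xs : List A) (ys : List B) →
  countᵇ p (cartesianProductWith f xs ys) ≡ sum (map (λ x → countᵇ (p ∘ f x) ys) xs)
countᵇ-cartesianProductWith p f [] ys = refl
countᵇ-cartesianProductWith p f (x ∷ xs) ys = begin
  countᵇ p (map (f x) ys ++ cartesianProductWith f xs ys)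
    ≡⟨ countᵇ-++ p (map (f x) ys) _ ⟩
  countᵇ p (map (f x) ys) + countᵇ p (cartesianProductWith f xs ys)
    ≡⟨ cong₂ _+_ (countᵇ-map p (f x) ys) (countᵇ-cartesianProductWith p f xs ys) ⟩
  countᵇ (p ∘ f x) ys + sum (map (λ x → countᵇ (p ∘ f x) ys) xs) ∎
  where open ≡-Reasoning

cartesianProductWith-singletonʳ : (f : A → B → R) (xs : List A) (y : B) →
  cartesianProductWith f xs (y ∷ []) ≡ map (λ x → f x y) xs
cartesianProductWith-singletonʳ f [] y = refl
cartesianProductWith-singletonʳ f (x ∷ xs) y = cong (f x y ∷_) (cartesianProductWith-singletonʳ f xs y)

countInsetsBy : (Q : List ℕ) → (ℕ → Bool) → ℕ
countInsetsBy Q φ = countᵇ (λ ss → meetsAll ss ∧ φ (size ss)) (allBlockSubsets Q)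

countInsetsBy-false : (Q : List ℕ) → countInsetsBy Q (λ _ → false) ≡ 0
countInsetsBy-false Q =
  trans (countᵇ-cong (λ ss → ∧-zeroʳ (meetsAll ss)) (allBlockSubsets Q)) (countᵇ-false (allBlockSubsets Q))

-- The four subsets of a two-element block are tried in turn: both elements,
-- either single element, and the empty set, which fails to meet the block.
countInsetsBy-pairBlock : (Q : List ℕ) (φ : ℕ → Bool) →
  countInsetsBy (2 ∷ Q) φ ≡ countInsetsBy Q (φ ∘ (2 +_)) + 2 * countInsetsBy Q (φ ∘ suc)
countInsetsBy-pairBlock Q φ = begin
  countInsetsBy (2 ∷ Q) φ
    ≡⟨ countᵇ-cartesianProductWith (λ ss → meetsAll ss ∧ φ (size ss)) _∷_ (allSubsets 2) L ⟩
  both + (single + (single + (countᵇ (λ _ → false) L + 0)))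
    ≡⟨ cong (λ c → both + (single + (single + (c + 0)))) (countᵇ-false L) ⟩
  both + 2 * single ∎
  where
  open ≡-Reasoning
  L = allBlockSubsets Q
  both single : ℕ
  both = countInsetsBy Q (φ ∘ (2 +_))
  single = countInsetsBy Q (φ ∘ suc)

insetCount-withoutAdditional : (Q : List ℕ) (k : ℕ) → insetCount 0 Q k ≡ countInsetsBy Q (_≡ᵇ length Q + k)
insetCount-withoutAdditional Q k = begin
  countᵇ (isInset k) (cartesianProductWith _,_ L ([] ∷ []))
    ≡⟨ cong (countᵇ (isInset k)) (cartesianProductWith-singletonʳ _,_ L []) ⟩
  countᵇ (isInset k) (map (_, []) L)
    ≡⟨ countᵇ-map (isInset k) (_, []) L ⟩
  countᵇ (λ ss → isInset k (ss , [])) L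
    ≡⟨ countᵇ-cong (λ ss → cong (meetsAll ss ∧_) (sizeTest ss)) L ⟩
  countInsetsBy Q (_≡ᵇ length Q + k) ∎
  where
  open ≡-Reasoning
  L = allBlockSubsets Q
  sizeTest : (ss : BlockSubsets Q) → isYes (size ss + 0 ≟ length Q + k) ≡ (size ss ≡ᵇ length Q + k)
  sizeTest ss = trans (isYes≗does (size ss + 0 ≟ _)) (cong (_≡ᵇ length Q + k) (+-identityʳ (size ss)))

-- Sizes are tested with _≡ᵇ_ rather than _≟_ so that shifting the target by the
-- first block's contribution is definitional: suc m ≡ᵇ suc n reduces to m ≡ᵇ n.
pairBlockInsets : ℕ → ℕ → ℕ
pairBlockInsets n j = countInsetsBy (replicate n 2) (_≡ᵇ j)

pairBlockInsets-suc-zero : (n : ℕ) → pairBlockInsets (suc n) 0 ≡ 0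
pairBlockInsets-suc-zero n = begin
  pairBlockInsets (suc n) 0
    ≡⟨ countInsetsBy-pairBlock (replicate n 2) (_≡ᵇ 0) ⟩
  countInsetsBy (replicate n 2) (λ _ → false) + 2 * countInsetsBy (replicate n 2) (λ _ → false)
    ≡⟨ cong (λ c → c + 2 * c) (countInsetsBy-false (replicate n 2)) ⟩
  0 ∎
  where open ≡-Reasoning

pairBlockInsets-suc-one : (n : ℕ) → pairBlockInsets (suc n) 1 ≡ 2 * pairBlockInsets n 0
pairBlockInsets-suc-one n =
  trans (countInsetsBy-pairBlock (replicate n 2) (_≡ᵇ 1))
        (cong (_+ 2 * pairBlockInsets n 0) (countInsetsBy-false (replicate n 2)))

pairBlockInsets-suc-suc : (n j : ℕ) →
  pairBlockInsets (suc n) (2 + j) ≡ pairBlockInsets n j + 2 * pairBlockInsets n (suc j)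
pairBlockInsets-suc-suc n j = countInsetsBy-pairBlock (replicate n 2) (_≡ᵇ 2 + j)

pairBlockInsets-below : {n j : ℕ} → j < n → pairBlockInsets n j ≡ 0
pairBlockInsets-below {suc n} {zero} _ = pairBlockInsets-suc-zero n
pairBlockInsets-below {suc n} {suc zero} (s≤s 0<n) =
  trans (pairBlockInsets-suc-one n) (cong (2 *_) (pairBlockInsets-below 0<n))
pairBlockInsets-below {suc n} {suc (suc j)} (s≤s 1+j<n) =
  trans (pairBlockInsets-suc-suc n j)
        (cong₂ (λ a b → a + 2 * b) (pairBlockInsets-below (≤-trans (n≤1+n _) 1+j<n)) (pairBlockInsets-below 1+j<n))

nC0≡1 : (n : ℕ) → n C 0 ≡ 1
nC0≡1 n = trans (nCk≡nC[n∸k] {0} {n} z≤n) (nCn≡1 n)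

2^[n∸k]*nCk-suc-zero : (n : ℕ) → 2 ^ (suc n ∸ 0) * (suc n C 0) ≡ 2 * (2 ^ (n ∸ 0) * (n C 0))
2^[n∸k]*nCk-suc-zero n = begin
  2 * 2 ^ n * (suc n C 0)  ≡⟨ cong (2 * 2 ^ n *_) (trans (nC0≡1 (suc n)) (sym (nC0≡1 n))) ⟩
  2 * 2 ^ n * (n C 0)      ≡⟨ *-assoc 2 (2 ^ n) (n C 0) ⟩
  2 * (2 ^ n * (n C 0))    ∎
  where open ≡-Reasoning

2^[n∸k]*nCk-suc-suc : (n k : ℕ) →
  2 ^ (suc n ∸ suc k) * (suc n C suc k) ≡ 2 ^ (n ∸ k) * (n C k) + 2 * (2 ^ (n ∸ suc k) * (n C suc k))
2^[n∸k]*nCk-suc-suc n k = begin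
  2 ^ (n ∸ k) * (suc n C suc k)
    ≡⟨ cong (2 ^ (n ∸ k) *_) (nCk+nC[k+1]≡[n+1]C[k+1] n k) ⟨
  2 ^ (n ∸ k) * (n C k + n C suc k)
    ≡⟨ *-distribˡ-+ (2 ^ (n ∸ k)) (n C k) (n C suc k) ⟩
  2 ^ (n ∸ k) * (n C k) + 2 ^ (n ∸ k) * (n C suc k)
    ≡⟨ cong (2 ^ (n ∸ k) * (n C k) +_) doubling ⟨
  2 ^ (n ∸ k) * (n C k) + 2 * (2 ^ (n ∸ suc k) * (n C suc k)) ∎
  where
  open ≡-Reasoning
  -- For k < n the exponent drops by one; otherwise C(n, k+1) = 0 and both sides vanish.
  doubling : 2 * (2 ^ (n ∸ suc k) * (n C suc k)) ≡ 2 ^ (n ∸ k) * (n C suc k)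
  doubling with k <? n
  ... | yes k<n = trans (sym (*-assoc 2 (2 ^ (n ∸ suc k)) (n C suc k)))
                        (cong (λ e → 2 ^ e * (n C suc k)) (sym (+-∸-assoc 1 k<n)))
  ... | no k≮n rewrite k>n⇒nCk≡0 {n} {suc k} (s≤s (≮⇒≥ k≮n))
                     | *-zeroʳ (2 ^ (n ∸ suc k)) | *-zeroʳ (2 ^ (n ∸ k)) = refl

pairBlockInsets-excess : (n k : ℕ) → pairBlockInsets n (n + k) ≡ 2 ^ (n ∸ k) * (n C k)
pairBlockInsets-excess zero zero = refl
pairBlockInsets-excess zero (suc k) = refl
pairBlockInsets-excess (suc zero) zero = refl
pairBlockInsets-excess (suc (suc n)) zero = begin
  pairBlockInsets (suc (suc n)) (2 + (n + 0))
    ≡⟨ pairBlockInsets-suc-suc (suc n) (n + 0) ⟩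
  pairBlockInsets (suc n) (n + 0) + 2 * pairBlockInsets (suc n) (suc n + 0)
    ≡⟨ cong₂ (λ a b → a + 2 * b) (pairBlockInsets-below (s≤s (≤-reflexive (+-identityʳ n))))
                                 (pairBlockInsets-excess (suc n) 0) ⟩
  2 * (2 ^ (suc n ∸ 0) * (suc n C 0))
    ≡⟨ 2^[n∸k]*nCk-suc-zero (suc n) ⟨
  2 ^ (suc (suc n) ∸ 0) * (suc (suc n) C 0) ∎
  where open ≡-Reasoning
pairBlockInsets-excess (suc n) (suc k) = begin
  pairBlockInsets (suc n) (suc (n + suc k))
    ≡⟨ cong (pairBlockInsets (suc n) ∘ suc) (+-suc n k) ⟩
  pairBlockInsets (suc n) (2 + (n + k))
    ≡⟨ pairBlockInsets-suc-suc n (n + k) ⟩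
  pairBlockInsets n (n + k) + 2 * pairBlockInsets n (suc (n + k))
    ≡⟨ cong₂ (λ a b → a + 2 * b) (pairBlockInsets-excess n k)
                                 (trans (cong (pairBlockInsets n) (sym (+-suc n k))) (pairBlockInsets-excess n (suc k))) ⟩
  2 ^ (n ∸ k) * (n C k) + 2 * (2 ^ (n ∸ suc k) * (n C suc k))
    ≡⟨ 2^[n∸k]*nCk-suc-suc n k ⟨
  2 ^ (suc n ∸ suc k) * (suc n C suc k) ∎
  where open ≡-Reasoning

mainTheorem3 : (n k : ℕ) → k ≤ n → insetCount 0 (replicate n 2) k ≡ 2 ^ (n ∸ k) * (n C k)
mainTheorem3 n k _ = begin
  insetCount 0 (replicate n 2) k
    ≡⟨ insetCount-withoutAdditional (replicate n 2) k ⟩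
  pairBlockInsets n (length (replicate n 2) + k)
    ≡⟨ cong (λ l → pairBlockInsets n (l + k)) (length-replicate n) ⟩
  pairBlockInsets n (n + k)
    ≡⟨ pairBlockInsets-excess n k ⟩
  2 ^ (n ∸ k) * (n C k) ∎
  where open ≡-Reasoning
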